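{- Let $\alpha \ge 2$ be an integer. Then: (i) every finite simple graph $G$ with vertex-edge diameter $d_{ve}(G)=2$ and independence number $\alpha(G)=\alpha$ satisfies $P(G) \le \alpha+2$, and there exists a graph of diameter $2$ (and vertex-edge diameter $2$) with independence number $\alpha$ and pegging number exactly $\alpha+2$; thus the maximum pegging number of graphs of vertex-edge diameter $2$ and independence number $\alpha$ is $\alpha+2$; (ii) if $G$ has $d_{ve}(G)=2$ and $\alpha(G)=\alpha$, then for every distribution of at least $\alpha+2$ pegs on $G$ and every vertex $t$, a peg can be placed on $t$ using at most $3$ pegging moves; (iii) if $G$ has $d_{ve}(G)=2$, $\alpha(G)=\alpha$ and $P(G)=\alpha+2$, then $G$ contains the graph $A$ below as an induced subgraph; and if moreover $G$ has diameter $2$, then $G$ contains the graph $B$ below as an induced subgraph. Here $A$ is the graph on vertices $t,u_1,u_2,v_1,v_2,v_3$ whose edges are exactly $v_1v_2, v_1v_3, v_2v_3, u_1v_1, u_2v_2, u_1u_2, tu_1, tu_2$; and $B$ is obtained from $A$ by adding one vertex $u_3$ adjacent to exactly $t, v_3, u_1, u_2$.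
   Context: All graphs are finite and simple. A graph is non-null if it has at least one edge. The distance between a vertex $x$ and an edge $e$ is the minimum distance from $x$ to an endpoint of $e$; the vertex-edge diameter $d_{ve}(G)$ of a non-null graph $G$ is the maximum distance between a vertex and an edge of $G$. $\alpha(G)$ denotes the independence number. A distribution of pegs on $G$ is a subset $D \subseteq V(G)$. If $u,v \in D$ are distinct adjacent vertices and $w \notin D$ is a vertex adjacent to $v$, the pegging move (jumping $u$ over $v$ into $w$) replaces $D$ by $(D\setminus\{u,v\})\cup\{w\}$. A vertex $t$ is reachable from $D$ if some finite (possibly empty) sequence of pegging moves starting from $D$ ends in a distribution containing $t$; $\mathrm{Reach}(D)$ is the set of reachable vertices. The pegging number $P(G)$ is the smallest positive integer $d$ such that every distribution of size $d$ on $G$ has reach $V(G)$. -}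

module Defs where

open import Data.Nat using (ℕ; zero; suc; _+_; _≤_; _<_)
open import Data.Fin using (Fin; zero; suc; _≟_; #_)
open import Data.Fin.Subset using (Subset; _∈_; _∉_; ∣_∣; _∪_; _-_; ⁅_⁆)
open import Data.Bool using (Bool; true; false; T; _∧_; _∨_)
open import Data.List using (List; []; _∷_)
open import Data.Product using (Σ; ∃; ∃-syntax; _×_; _,_)
open import Data.Sum using (_⊎_)
open import Relation.Nullary using (¬_)
open import Relation.Nullary.Decidable using (⌊_⌋)
open import Relation.Binary.PropositionalEquality using (_≡_; _≢_)
open import Function using (_⇔_)
open import Function.Definitions using (Injective)

record Graph (n : ℕ) : Set where
  field
    adj   : Fin n → Fin n → Bool
    sym   : ∀ u v → adj u v ≡ adj v u
    irref : ∀ v → adj v v ≡ false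

open Graph public

Adj : ∀ {n} → Graph n → Fin n → Fin n → Set
Adj G u v = T (adj G u v)

data Walk {n} (G : Graph n) : Fin n → Fin n → ℕ → Set where
  here : ∀ {x} → Walk G x x 0
  step : ∀ {x y z k} → Adj G x y → Walk G y z k → Walk G x z (suc k)

DistLe : ∀ {n} → Graph n → Fin n → Fin n → ℕ → Set
DistLe G x y k = ∃[ j ] (j ≤ k × Walk G x y j)

VEDistLe : ∀ {n} → Graph n → Fin n → Fin n → Fin n → ℕ → Set
VEDistLe G x u v k = DistLe G x u k ⊎ DistLe G x v k

NonNull : ∀ {n} → Graph n → Set
NonNull G = ∃[ u ] ∃[ v ] Adj G u v

VEBound : ∀ {n} → Graph n → ℕ → Set
VEBound G k = ∀ x u v → Adj G u v → VEDistLe G x u v k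

VEDiam : ∀ {n} → Graph n → ℕ → Set
VEDiam G d = NonNull G × VEBound G d × (∀ k → VEBound G k → d ≤ k)

DiamBound : ∀ {n} → Graph n → ℕ → Set
DiamBound G k = ∀ x y → DistLe G x y k

Diam : ∀ {n} → Graph n → ℕ → Set
Diam G d = DiamBound G d × (∀ k → DiamBound G k → d ≤ k)

Independent : ∀ {n} → Graph n → Subset n → Set
Independent G S = ∀ x y → x ∈ S → y ∈ S → ¬ Adj G x y

IndepNum : ∀ {n} → Graph n → ℕ → Set
IndepNum G a = (∃[ S ] (Independent G S × ∣ S ∣ ≡ a))
             × (∀ S → Independent G S → ∣ S ∣ ≤ a)

Move : ∀ {n} → Graph n → Subset n → Subset n → Set
Move G D D′ = ∃[ u ] ∃[ v ] ∃[ w ]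
  ( u ∈ D × v ∈ D × u ≢ v × Adj G u v × w ∉ D × Adj G v w
  × D′ ≡ (D - u - v) ∪ ⁅ w ⁆ )

data Moves {n} (G : Graph n) : ℕ → Subset n → Subset n → Set where
  done : ∀ {D} → Moves G 0 D D
  more : ∀ {k D D′ D″} → Move G D D′ → Moves G k D′ D″ → Moves G (suc k) D D″

ReachWithin : ∀ {n} → Graph n → ℕ → Subset n → Fin n → Set
ReachWithin G m D t = ∃[ k ] ∃[ D′ ] (k ≤ m × Moves G k D D′ × t ∈ D′)

Reachable : ∀ {n} → Graph n → Subset n → Fin n → Set
Reachable G D t = ∃[ k ] ∃[ D′ ] (Moves G k D D′ × t ∈ D′)

GoodSize : ∀ {n} → Graph n → ℕ → Set
GoodSize G d = ∀ D → ∣ D ∣ ≡ d → ∀ t → Reachable G D t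

PegNum : ∀ {n} → Graph n → ℕ → Set
PegNum G p = 1 ≤ p × GoodSize G p × (∀ d → 1 ≤ d → d < p → ¬ GoodSize G d)

edgeAdj : ∀ {m} → List (Fin m × Fin m) → Fin m → Fin m → Bool
edgeAdj [] i j = false
edgeAdj ((a , b) ∷ es) i j =
  ((⌊ i ≟ a ⌋ ∧ ⌊ j ≟ b ⌋) ∨ (⌊ i ≟ b ⌋ ∧ ⌊ j ≟ a ⌋)) ∨ edgeAdj es i j

InducedSub : ∀ {m n} → (Fin m → Fin m → Bool) → Graph n → Set
InducedSub {m} H G = ∃[ f ] (Injective _≡_ _≡_ f
  × (∀ i j → Adj G (f i) (f j) ⇔ T (H i j)))

-- Vertex numbering: t = 0, u₁ = 1, u₂ = 2, v₁ = 3, v₂ = 4, v₃ = 5, u₃ = 6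

graphA : Fin 6 → Fin 6 → Bool
graphA = edgeAdj
  ( (# 3 , # 4) ∷ (# 3 , # 5) ∷ (# 4 , # 5) ∷ (# 1 , # 3) ∷ (# 2 , # 4) ∷ (# 1 , # 2)
  ∷ (# 0 , # 1) ∷ (# 0 , # 2) ∷ [])

graphB : Fin 7 → Fin 7 → Bool
graphB = edgeAdj
  ( (# 3 , # 4) ∷ (# 3 , # 5) ∷ (# 4 , # 5) ∷ (# 1 , # 3) ∷ (# 2 , # 4) ∷ (# 1 , # 2)
  ∷ (# 0 , # 1) ∷ (# 0 , # 2)
  ∷ (# 6 , # 0) ∷ (# 6 , # 5) ∷ (# 6 , # 1) ∷ (# 6 , # 2) ∷ [])

module Submission where

-- Let D be a distribution containing a pegged edge ab and t ∉ D. If t has a pegged neighbour y,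
-- then y lies within distance 2 of a or b and two jumps bring a peg to t. Otherwise, since
-- d_ve(G) = 2, t has a neighbour w adjacent to a (say); jumping b over a onto w gives t a pegged
-- neighbour, so two further jumps suffice unless the new distribution of ∣ D ∣ - 1 pegs is
-- independent. With α + 2 pegs that is impossible, which gives (ii) and the bound of (i).
-- With α + 1 pegs and t unreachable, the same dichotomy, applied to every pegged edge, forces
-- a pegged triangle v₁v₂v₃ and neighbours u₁, u₂ (and u₃ if diam G = 2) of t with uᵢ ~ vᵢ;
-- each adjacency among these vertices that differs from A (resp. B) would yield an independent
-- set of α + 1 vertices. In the example, pegs on the inner tris and leaves either stay inside
-- the inner part with at most one tri beside a pegged hub, or end up independent, so the
-- target is never reached.

open import Defs hiding (sym)
open import Data.Nat using (ℕ; zero; suc; _+_; _≤_; _<_; z≤n; s≤s)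
open import Data.Nat.Properties using (≰⇒>; ≤-antisym; ≤-trans; ≤-refl; ≤-reflexive; n≤1+n; n<1+n; +-comm; ≤-pred; ≮⇒≥; ≤⇒≯; m≤n+m; +-monoʳ-<)
open import Data.Fin using (Fin; zero; suc; _≟_; _↑ˡ_; _↑ʳ_; splitAt)
open import Data.Fin.Properties using (any?; all?; suc-injective; 0≢1+n; splitAt-↑ˡ; splitAt-↑ʳ; splitAt⁻¹-↑ˡ; splitAt⁻¹-↑ʳ)
open import Data.Fin.Subset using (Subset; ⊤; ∣_∣; _∈_; _∉_; _⊆_; _∪_; _-_; ⁅_⁆; _─_; inside; outside)
open import Data.Fin.Subset.Properties
  using (_∈?_; x∈p∪q⁻; x∈p∪q⁺; p─q⊆p; x∈⁅x⁆; x∈⁅y⁆⇒x≡y; x∈p∧x≢y⇒x∈p-y; p─⊥≡p; ∪-identityʳ; ∈⊤; ∣⊤∣≡n)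
open import Data.Vec using (Vec; _∷_; []; here; there; lookup; tabulate)
open import Data.Vec.Properties using (lookup∘tabulate; lookup⇒[]=; []=⇒lookup)
open import Data.Vec.Relation.Binary.Pointwise.Inductive as Pointwise using (Pointwise; _∷_; [])
open import Function using (_∘_; id; flip; case_of_; mk⇔; Equivalence)
open import Function.Definitions using (Injective)
open import Data.Product using (Σ; ∃; ∃-syntax; _×_; _,_; proj₁; proj₂)
open import Data.Sum using (_⊎_; inj₁; inj₂; [_,_]′)
import Data.Sum as Sum
import Data.Sum.Effectful.Left as SumLeft
open import Effect.Monad using (RawMonad)
open import Level using (0ℓ)
open import Data.Empty using (⊥; ⊥-elim)
open import Data.Bool using (Bool; true; false; T; not; _∨_)
import Data.Bool.Properties as Bool
open import Data.Bool.Properties using (T-≡; T-∨)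
open import Data.Unit using (tt)
open import Relation.Nullary using (¬_; Dec; yes; no; contradiction)
open import Relation.Nullary.Decidable using (_×-dec_; _⊎-dec_; _→-dec_; toWitnessFalse; T?; map′; ¬?; toSum; True; toWitness; fromWitness; fromWitnessFalse; ⌊_⌋)
open import Relation.Binary.PropositionalEquality using (_≡_; _≢_; refl; sym; trans; cong; subst; subst₂; module ≡-Reasoning)
open import Relation.Binary.Definitions using (DecidableEquality)

module _ {n : ℕ} (G : Graph n) where

  Adj-sym : ∀ {u v} → Adj G u v → Adj G v u
  Adj-sym {u} {v} = subst T (Graph.sym G u v)

  Adj-irrefl : ∀ {u} → ¬ Adj G u u
  Adj-irrefl {u} = subst T (irref G u)

  Adj⇒≢ : ∀ {u v} → Adj G u v → u ≢ v
  Adj⇒≢ uv refl = Adj-irrefl uv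

  Adj? : ∀ u v → Dec (Adj G u v)
  Adj? u v = T? (adj G u v)

  DistLe≤1-view : ∀ {x y m} → DistLe G x y m → m ≤ 1 → x ≡ y ⊎ Adj G x y
  DistLe≤1-view (0 , _ , here) _ = inj₁ refl
  DistLe≤1-view (1 , _ , step xy here) _ = inj₂ xy
  DistLe≤1-view (suc (suc _) , j≤m , _) m≤1 = contradiction (≤-trans j≤m m≤1) λ { (s≤s ()) }

  DistLe≤2-view : ∀ {x y} → DistLe G x y 2 → x ≡ y ⊎ Adj G x y ⊎ ∃[ z ] (Adj G x z × Adj G z y)
  DistLe≤2-view (0 , _ , here) = inj₁ refl
  DistLe≤2-view (1 , _ , step xy here) = inj₂ (inj₁ xy)
  DistLe≤2-view (2 , _ , step xz (step zy here)) = inj₂ (inj₂ (_ , xz , zy))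
  DistLe≤2-view (suc (suc (suc _)) , s≤s (s≤s ()) , _)

x∈p-y⇒x∈p : ∀ {n} {p : Subset n} {x y} → x ∈ p - y → x ∈ p
x∈p-y⇒x∈p {p = p} {y = y} = p─q⊆p p ⁅ y ⁆

x∈p-y⇒x≢y : ∀ {n} {p : Subset n} {x y} → x ∈ p - y → x ≢ y
x∈p-y⇒x≢y {p = p} {y = y} x∈ refl = go p ⁅ y ⁆ x∈ (x∈⁅x⁆ y)
  where
  go : ∀ {n} (p q : Subset n) {x} → x ∈ p ─ q → x ∉ q
  go (_ ∷ p) (inside ∷ q) () here
  go (_ ∷ p) (_ ∷ q) (there x∈) (there x∈q) = go p q x∈ x∈q

x∈p⇒∣p∣≡suc∣p-x∣ : ∀ {n} (p : Subset n) x → x ∈ p → ∣ p ∣ ≡ suc ∣ p - x ∣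
x∈p⇒∣p∣≡suc∣p-x∣ (inside ∷ p) zero here = cong (λ q → suc ∣ q ∣) (sym (p─⊥≡p p))
x∈p⇒∣p∣≡suc∣p-x∣ (inside ∷ p) (suc x) (there x∈) = cong suc (x∈p⇒∣p∣≡suc∣p-x∣ p x x∈)
x∈p⇒∣p∣≡suc∣p-x∣ (outside ∷ p) (suc x) (there x∈) = x∈p⇒∣p∣≡suc∣p-x∣ p x x∈

x∉p⇒∣p∪⁅x⁆∣≡suc∣p∣ : ∀ {n} (p : Subset n) x → x ∉ p → ∣ p ∪ ⁅ x ⁆ ∣ ≡ suc ∣ p ∣
x∉p⇒∣p∪⁅x⁆∣≡suc∣p∣ (inside ∷ p) zero x∉ = contradiction here x∉
x∉p⇒∣p∪⁅x⁆∣≡suc∣p∣ (outside ∷ p) zero x∉ = cong (λ q → suc ∣ q ∣) (∪-identityʳ p)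
x∉p⇒∣p∪⁅x⁆∣≡suc∣p∣ (inside ∷ p) (suc x) x∉ = cong suc (x∉p⇒∣p∪⁅x⁆∣≡suc∣p∣ p x (x∉ ∘ there))
x∉p⇒∣p∪⁅x⁆∣≡suc∣p∣ (outside ∷ p) (suc x) x∉ = x∉p⇒∣p∪⁅x⁆∣≡suc∣p∣ p x (x∉ ∘ there)

∈-∪⁅⁆⁻ : ∀ {n} (p : Subset n) {x y} → x ∈ p ∪ ⁅ y ⁆ → x ∈ p ⊎ x ≡ y
∈-∪⁅⁆⁻ p {y = y} x∈ = Sum.map₂ (x∈⁅y⁆⇒x≡y y) (x∈p∪q⁻ p ⁅ y ⁆ x∈)

∣p-x∪⁅y⁆∣≡∣p∣ : ∀ {n} (p : Subset n) {x y} → x ∈ p → y ∉ p → ∣ (p - x) ∪ ⁅ y ⁆ ∣ ≡ ∣ p ∣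
∣p-x∪⁅y⁆∣≡∣p∣ p {x} {y} x∈ y∉ =
  trans (x∉p⇒∣p∪⁅x⁆∣≡suc∣p∣ (p - x) y (y∉ ∘ x∈p-y⇒x∈p)) (sym (x∈p⇒∣p∣≡suc∣p-x∣ p x x∈))

IndepBound : ∀ {n} → Graph n → ℕ → Set
IndepBound G α = ∀ S → Independent G S → ∣ S ∣ ≤ α

large⇒¬Independent : ∀ {n} (G : Graph n) {α} → IndepBound G α → ∀ S → α < ∣ S ∣ → ¬ Independent G S
large⇒¬Independent G bound S α<∣S∣ ind = ≤⇒≯ (bound S ind) α<∣S∣

injectiveOn⇒∣p∣≤∣q∣ : ∀ {n m} (p : Subset n) (q : Subset m) (f : Fin n → Fin m) →
                     (∀ {x} → x ∈ p → f x ∈ q) → (∀ {x y} → x ∈ p → y ∈ p → f x ≡ f y → x ≡ y) → ∣ p ∣ ≤ ∣ q ∣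
injectiveOn⇒∣p∣≤∣q∣ [] q f _ _ = z≤n
injectiveOn⇒∣p∣≤∣q∣ (outside ∷ p) q f into injective =
  injectiveOn⇒∣p∣≤∣q∣ p q (f ∘ suc) (into ∘ there) λ x∈ y∈ → suc-injective ∘ injective (there x∈) (there y∈)
injectiveOn⇒∣p∣≤∣q∣ (inside ∷ p) q f into injective =
  subst (suc ∣ p ∣ ≤_) (sym (x∈p⇒∣p∣≡suc∣p-x∣ q (f zero) (into here))) (s≤s
    (injectiveOn⇒∣p∣≤∣q∣ p (q - f zero) (f ∘ suc)
      (λ x∈ → x∈p∧x≢y⇒x∈p-y (into (there x∈)) λ fx≡f0 → 0≢1+n (injective here (there x∈) (sym fx≡f0)))
      λ x∈ y∈ → suc-injective ∘ injective (there x∈) (there y∈)))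

subset-of-size : ∀ {n} (p : Subset n) {d} → d ≤ ∣ p ∣ → ∃[ q ] (q ⊆ p × ∣ q ∣ ≡ d)
subset-of-size [] {zero} _ = [] , id , refl
subset-of-size (outside ∷ p) d≤ with subset-of-size p d≤
... | q , q⊆p , ∣q∣≡d = outside ∷ q , (λ { (there x∈) → there (q⊆p x∈) }) , ∣q∣≡d
subset-of-size (inside ∷ p) {zero} _ with subset-of-size p {zero} z≤n
... | q , q⊆p , ∣q∣≡0 = outside ∷ q , (λ { (there x∈) → there (q⊆p x∈) }) , ∣q∣≡0
subset-of-size (inside ∷ p) {suc d} (s≤s d≤) with subset-of-size p d≤
... | q , q⊆p , ∣q∣≡d = inside ∷ q , (λ { here → here ; (there x∈) → there (q⊆p x∈) }) , cong suc ∣q∣≡d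

image : ∀ {m n} → (Fin m → Fin n) → Subset n
image g = tabulate λ x → ⌊ any? (λ i → g i ≟ x) ⌋

module _ {m n} {g : Fin m → Fin n} where

  ∈-image⁺ : ∀ i → g i ∈ image g
  ∈-image⁺ i = lookup⇒[]= (g i) (image g)
    (trans (lookup∘tabulate _ (g i)) (Equivalence.to T-≡ (fromWitness (i , refl))))

  ∈-image⁻ : ∀ {x} → x ∈ image g → ∃[ i ] g i ≡ x
  ∈-image⁻ {x} x∈ = toWitness (subst T (sym (trans (sym (lookup∘tabulate _ x)) ([]=⇒lookup x∈))) tt)

  injective⇒m≤∣image∣ : Injective _≡_ _≡_ g → m ≤ ∣ image g ∣
  injective⇒m≤∣image∣ injective = subst (_≤ ∣ image g ∣) (∣⊤∣≡n m)
    (injectiveOn⇒∣p∣≤∣q∣ ⊤ (image g) g (λ {i} _ → ∈-image⁺ i) λ _ _ → injective)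

edge : ∀ {b} → T b → b ≡ true
edge = Equivalence.to T-≡

non-edge : ∀ {b} → ¬ T b → b ≡ false
non-edge {false} _ = refl
non-edge {true} ¬b = contradiction tt ¬b

tail : ∀ {m} → Graph (suc m) → Graph m
tail H = record { adj = λ i j → adj H (suc i) (suc j) ; sym = λ i j → Graph.sym H (suc i) (suc j) ; irref = irref H ∘ suc }

record InducedBy {m n} (G : Graph n) (H : Graph m) (xs : Vec (Fin n) m) : Set where
  constructor induced
  field adj-≡ : ∀ i j → adj G (lookup xs i) (lookup xs j) ≡ adj H i j

module _ {n : ℕ} {G : Graph n} where

  ∅ : {H : Graph 0} → InducedBy G H []
  ∅ = induced λ ()

  infixr 4 _◂_

  _◂_ : ∀ {m} {H : Graph (suc m)} {x xs} →
        Pointwise (λ y b → adj G x y ≡ b) xs (tabulate (adj H zero ∘ suc)) →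
        InducedBy G (tail H) xs → InducedBy G H (x ∷ xs)
  _◂_ {H = H} {x} {xs} row (induced rest) = induced go
    where
    row-at : ∀ j → adj G x (lookup xs j) ≡ adj H zero (suc j)
    row-at j = trans (Pointwise.lookup row j) (lookup∘tabulate (adj H zero ∘ suc) j)
    go : ∀ i j → adj G (lookup (x ∷ xs) i) (lookup (x ∷ xs) j) ≡ adj H i j
    go zero zero = trans (irref G x) (sym (irref H zero))
    go zero (suc j) = row-at j
    go (suc i) zero = trans (Graph.sym G _ x) (trans (row-at i) (Graph.sym H zero (suc i)))
    go (suc i) (suc j) = rest i j

  inducedBy? : ∀ {m} (H : Graph m) xs → Dec (InducedBy G H xs)
  inducedBy? H xs = map′ induced InducedBy.adj-≡
    (all? λ i → all? λ j → adj G (lookup xs i) (lookup xs j) Bool.≟ adj H i j)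

anyVec? : ∀ {m n} {P : Vec (Fin n) m → Set} → (∀ xs → Dec (P xs)) → Dec (∃ P)
anyVec? {zero} P? = map′ ([] ,_) (λ { ([] , p) → p }) (P? [])
anyVec? {suc m} P? = map′ (λ (x , xs , p) → x ∷ xs , p) (λ { (x ∷ xs , p) → x , xs , p })
  (any? λ x → anyVec? λ xs → P? (x ∷ xs))

Contains : ∀ {m n} → Graph n → Graph m → Set
Contains G H = ∃[ xs ] InducedBy G H xs

contains? : ∀ {m n} (G : Graph n) (H : Graph m) → Dec (Contains G H)
contains? G H = anyVec? (inducedBy? {G = G} H)

TwinFree : ∀ {m} → Graph m → Set
TwinFree H = ∀ i j → i ≡ j ⊎ ∃[ k ] (adj H i k ≢ adj H j k)

-- vertices of H with different neighbourhoods cannot be listed as the same vertex of G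
Contains⇒InducedSub : ∀ {m n} {G : Graph n} (H : Graph m) → TwinFree H → Contains G H → InducedSub (adj H) G
Contains⇒InducedSub {G = G} H twin-free (xs , induced adj-≡) = lookup xs , injective , λ i j →
  mk⇔ (subst T (adj-≡ i j)) (subst T (sym (adj-≡ i j)))
  where
  injective : Injective _≡_ _≡_ (lookup xs)
  injective {i} {j} xsᵢ≡xsⱼ with twin-free i j
  ... | inj₁ i≡j = i≡j
  ... | inj₂ (k , differ) = contradiction
    (trans (sym (adj-≡ i k)) (trans (cong (λ x → adj G x (lookup xs k)) xsᵢ≡xsⱼ) (adj-≡ j k))) differ

asGraph : ∀ {m} (H : Fin m → Fin m → Bool) →
          True (all? λ i → all? λ j → H i j Bool.≟ H j i) → True (all? λ i → H i i Bool.≟ false) → Graph m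
asGraph H symmetric irreflexive = record { adj = H ; sym = toWitness symmetric ; irref = toWitness irreflexive }

twinFree? : ∀ {m} (H : Graph m) → Dec (TwinFree H)
twinFree? H = all? λ i → all? λ j → (i ≟ j) ⊎-dec any? λ k → ¬? (adj H i k Bool.≟ adj H j k)

graphᴬ : Graph 6
graphᴬ = asGraph graphA tt tt

graphᴮ : Graph 7
graphᴮ = asGraph graphB tt tt

graphᴬ-twinFree : TwinFree graphᴬ
graphᴬ-twinFree = toWitness {a? = twinFree? graphᴬ} tt

graphᴮ-twinFree : TwinFree graphᴮ
graphᴮ-twinFree = toWitness {a? = twinFree? graphᴮ} tt

jumped : ∀ {n} → Subset n → Fin n → Fin n → Fin n → Subset n
jumped D u v w = (D - u - v) ∪ ⁅ w ⁆

module _ {n : ℕ} {D : Subset n} {u v w : Fin n} where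

  ∈-jumped⁻ : ∀ {x} → x ∈ jumped D u v w → (x ∈ D × x ≢ u × x ≢ v) ⊎ x ≡ w
  ∈-jumped⁻ x∈ with ∈-∪⁅⁆⁻ (D - u - v) x∈
  ... | inj₁ x∈D-u-v = inj₁ (x∈p-y⇒x∈p (x∈p-y⇒x∈p x∈D-u-v) , x∈p-y⇒x≢y (x∈p-y⇒x∈p x∈D-u-v) , x∈p-y⇒x≢y x∈D-u-v)
  ... | inj₂ x≡w = inj₂ x≡w

  ∈-jumped⁺ : ∀ {x} → x ∈ D → x ≢ u → x ≢ v → x ∈ jumped D u v w
  ∈-jumped⁺ x∈ x≢u x≢v = x∈p∪q⁺ (inj₁ (x∈p∧x≢y⇒x∈p-y (x∈p∧x≢y⇒x∈p-y x∈ x≢u) x≢v))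

  landing∈jumped : w ∈ jumped D u v w
  landing∈jumped = x∈p∪q⁺ (inj₂ (x∈⁅x⁆ w))

  ∉-jumped : ∀ {x} → x ∉ D → x ≢ w → x ∉ jumped D u v w
  ∉-jumped x∉ x≢w x∈ with ∈-jumped⁻ x∈
  ... | inj₁ (x∈D , _) = x∉ x∈D
  ... | inj₂ x≡w = x≢w x≡w

  suc∣jumped∣≡∣D∣ : u ∈ D → v ∈ D → v ≢ u → w ∉ D → suc ∣ jumped D u v w ∣ ≡ ∣ D ∣
  suc∣jumped∣≡∣D∣ u∈ v∈ v≢u w∉ = begin
    suc ∣ (D - u - v) ∪ ⁅ w ⁆ ∣ ≡⟨ cong suc (x∉p⇒∣p∪⁅x⁆∣≡suc∣p∣ (D - u - v) w (w∉ ∘ x∈p-y⇒x∈p ∘ x∈p-y⇒x∈p)) ⟩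
    suc (suc ∣ D - u - v ∣)     ≡⟨ cong suc (x∈p⇒∣p∣≡suc∣p-x∣ (D - u) v (x∈p∧x≢y⇒x∈p-y v∈ v≢u)) ⟨
    suc ∣ D - u ∣               ≡⟨ x∈p⇒∣p∣≡suc∣p-x∣ D u u∈ ⟨
    ∣ D ∣                       ∎
    where open ≡-Reasoning

module Pegging {n : ℕ} (G : Graph n) where

  jump : ∀ {D u v w} → u ∈ D → v ∈ D → Adj G u v → w ∉ D → Adj G v w → Move G D (jumped D u v w)
  jump u∈ v∈ uv w∉ vw = _ , _ , _ , u∈ , v∈ , Adj⇒≢ G uv , uv , w∉ , vw , refl

  reach-now : ∀ {m D t} → t ∈ D → ReachWithin G m D t
  reach-now t∈ = 0 , _ , z≤n , done , t∈

  reach-after : ∀ {m D D′ t} → Move G D D′ → ReachWithin G m D′ t → ReachWithin G (suc m) D t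
  reach-after mv (k , E , k≤m , mvs , t∈) = suc k , E , s≤s k≤m , more mv mvs , t∈

  reach-mono : ∀ {m D t} → ReachWithin G m D t → ReachWithin G (suc m) D t
  reach-mono {m} (k , E , k≤m , mvs , t∈) = k , E , ≤-trans k≤m (n≤1+n m) , mvs , t∈

  reachable : ∀ {m D t} → ReachWithin G m D t → Reachable G D t
  reachable (k , E , _ , mvs , t∈) = k , E , mvs , t∈

  jump-into : ∀ {m D u v t} → u ∈ D → v ∈ D → Adj G u v → t ∉ D → Adj G v t → ReachWithin G (suc m) D t
  jump-into u∈ v∈ uv t∉ vt = reach-after (jump u∈ v∈ uv t∉ vt) (reach-now landing∈jumped)

  HasEdge : Subset n → Set
  HasEdge D = ∃[ a ] ∃[ b ] (a ∈ D × b ∈ D × Adj G a b)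

  hasEdge? : ∀ D → Dec (HasEdge D)
  hasEdge? D = any? λ a → any? λ b → (a ∈? D) ×-dec (b ∈? D) ×-dec Adj? G a b

  ¬HasEdge⇒Independent : ∀ {D} → ¬ HasEdge D → Independent G D
  ¬HasEdge⇒Independent ¬e x y x∈ y∈ xy = ¬e (x , y , x∈ , y∈ , xy)

  PeggedNeighbour : Subset n → Fin n → Set
  PeggedNeighbour D t = ∃[ y ] (y ∈ D × Adj G y t)

  peggedNeighbour? : ∀ D t → Dec (PeggedNeighbour D t)
  peggedNeighbour? D t = any? λ y → (y ∈? D) ×-dec Adj? G y t

module VertexEdgeDiameter≤2 {n : ℕ} (G : Graph n) (ve : VEBound G 2) where
  open Pegging G

  reach₂-through-endpoint : ∀ {D t y a b} → t ∉ D → y ∈ D → Adj G y t → a ∈ D → b ∈ D → Adj G a b →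
                            ¬ Adj G a t → ¬ Adj G b t → DistLe G y a 2 → ReachWithin G 2 D t
  reach₂-through-endpoint {D} {t} t∉ y∈ yt a∈ b∈ ab ¬at ¬bt ya with DistLe≤2-view G ya
  ... | inj₁ refl = contradiction yt ¬at
  ... | inj₂ (inj₁ ya) = jump-into a∈ y∈ (Adj-sym G ya) t∉ yt
  ... | inj₂ (inj₂ (z , yz , za)) with z ∈? D | z ≟ t
  ...   | yes z∈ | _        = jump-into z∈ y∈ (Adj-sym G yz) t∉ yt
  ...   | no _   | yes refl = contradiction (Adj-sym G za) ¬at
  ...   | no z∉  | no z≢t   =
    reach-after (jump b∈ a∈ (Adj-sym G ab) z∉ (Adj-sym G za))
      (jump-into landing∈jumped (∈-jumped⁺ y∈ (λ { refl → ¬bt yt }) (λ { refl → ¬at yt }))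
                 (Adj-sym G yz) (∉-jumped t∉ (z≢t ∘ sym)) yt)

  reach₂-from-peggedNeighbour : ∀ {D t y a b} → t ∉ D → y ∈ D → Adj G y t →
                                a ∈ D → b ∈ D → Adj G a b → ReachWithin G 2 D t
  reach₂-from-peggedNeighbour {D} {t} {y} {a} {b} t∉ y∈ yt a∈ b∈ ab with Adj? G a t | Adj? G b t
  ... | yes at | _      = jump-into b∈ a∈ (Adj-sym G ab) t∉ at
  ... | no _   | yes bt = jump-into a∈ b∈ ab t∉ bt
  ... | no ¬at | no ¬bt with ve y a b ab
  ...   | inj₁ ya = reach₂-through-endpoint t∉ y∈ yt a∈ b∈ ab ¬at ¬bt ya
  ...   | inj₂ yb = reach₂-through-endpoint t∉ y∈ yt b∈ a∈ (Adj-sym G ab) ¬bt ¬at yb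

  module Lonely {D : Subset n} {t : Fin n} (t∉ : t ∉ D) (lonely : ¬ PeggedNeighbour D t) where

    Bridge : Fin n → Set
    Bridge a = ∃[ w ] (Adj G t w × Adj G w a)

    bridge-to : ∀ {a} → a ∈ D → DistLe G t a 2 → Bridge a
    bridge-to a∈ ta with DistLe≤2-view G ta
    ... | inj₁ refl = contradiction a∈ t∉
    ... | inj₂ (inj₁ ta) = contradiction (_ , a∈ , Adj-sym G ta) lonely
    ... | inj₂ (inj₂ w,tw,wa) = w,tw,wa

    bridge : ∀ {a b} → a ∈ D → b ∈ D → Adj G a b → Bridge a ⊎ Bridge b
    bridge {a} {b} a∈ b∈ ab with ve t a b ab
    ... | inj₁ ta = inj₁ (bridge-to a∈ ta)
    ... | inj₂ tb = inj₂ (bridge-to b∈ tb)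

    bridge∉ : ∀ {w} → Adj G t w → w ∉ D
    bridge∉ tw w∈ = lonely (_ , w∈ , Adj-sym G tw)

    -- jumping b over a onto the bridge w gives t a pegged neighbour
    reach₃-or-independent : ∀ {a b w} → a ∈ D → b ∈ D → Adj G a b → Adj G t w → Adj G w a →
                            ReachWithin G 3 D t ⊎ Independent G (jumped D b a w)
    reach₃-or-independent {a} {b} {w} a∈ b∈ ab tw wa with hasEdge? (jumped D b a w)
    ... | no ¬e = inj₂ (¬HasEdge⇒Independent ¬e)
    ... | yes (c , d , c∈ , d∈ , cd) =
      inj₁ (reach-after (jump b∈ a∈ (Adj-sym G ab) (bridge∉ tw) (Adj-sym G wa))
              (reach₂-from-peggedNeighbour (∉-jumped t∉ (Adj⇒≢ G tw)) landing∈jumped (Adj-sym G tw) c∈ d∈ cd))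

  module _ {α : ℕ} (bound : IndepBound G α) where

    reach₃-across-bridge : ∀ {D t a b w} → suc (suc α) ≤ ∣ D ∣ → (t∉ : t ∉ D) (lonely : ¬ PeggedNeighbour D t) →
                           a ∈ D → b ∈ D → Adj G a b → Adj G t w → Adj G w a → ReachWithin G 3 D t
    reach₃-across-bridge {D} {a = a} {b} {w} big t∉ lonely a∈ b∈ ab tw wa
      with Lonely.reach₃-or-independent t∉ lonely a∈ b∈ ab tw wa
    ... | inj₁ reach = reach
    ... | inj₂ ind = contradiction ind (large⇒¬Independent G bound (jumped D b a w) (≤-pred (subst (suc (suc α) ≤_)
            (sym (suc∣jumped∣≡∣D∣ b∈ a∈ (Adj⇒≢ G ab) (Lonely.bridge∉ t∉ lonely tw))) big)))

    reach-within-3′ : ∀ D → suc (suc α) ≤ ∣ D ∣ → ∀ t → ReachWithin G 3 D t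
    reach-within-3′ D big t with t ∈? D
    ... | yes t∈ = reach-now t∈
    ... | no t∉ with hasEdge? D
    ...   | no ¬e = contradiction (¬HasEdge⇒Independent ¬e) (large⇒¬Independent G bound D (≤-trans (n≤1+n _) big))
    ...   | yes (a , b , a∈ , b∈ , ab) with peggedNeighbour? D t
    ...     | yes (y , y∈ , yt) = reach-mono (reach₂-from-peggedNeighbour t∉ y∈ yt a∈ b∈ ab)
    ...     | no lonely with Lonely.bridge t∉ lonely a∈ b∈ ab
    ...       | inj₁ (w , tw , wa) = reach₃-across-bridge big t∉ lonely a∈ b∈ ab tw wa
    ...       | inj₂ (w , tw , wb) = reach₃-across-bridge big t∉ lonely b∈ a∈ (Adj-sym G ab) tw wb

    reach-within-3 : ∀ D → α + 2 ≤ ∣ D ∣ → ∀ t → ReachWithin G 3 D t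
    reach-within-3 D α+2≤∣D∣ = reach-within-3′ D (subst (_≤ ∣ D ∣) (+-comm α 2) α+2≤∣D∣)

-- Distributions of α + 1 pegs missing a vertex

module Extremal {n : ℕ} (G : Graph n) (ve : VEBound G 2) {α : ℕ} (bound : IndepBound G α)
                {D : Subset n} (∣D∣≡1+α : ∣ D ∣ ≡ suc α) {t : Fin n} (t∉ : t ∉ D)
                (lonely : ¬ Pegging.PeggedNeighbour G D t) where
  open Pegging G
  open VertexEdgeDiameter≤2 G ve
  open Lonely t∉ lonely
  open RawMonad (SumLeft.monad (Reachable G D t) 0ℓ) using (_>>=_; pure)

  ∣S∣≡∣D∣⇒¬Independent : ∀ S → ∣ S ∣ ≡ ∣ D ∣ → ¬ Independent G S
  ∣S∣≡∣D∣⇒¬Independent S ∣S∣≡∣D∣ = large⇒¬Independent G bound S (subst (suc α ≤_) (sym (trans ∣S∣≡∣D∣ ∣D∣≡1+α)) ≤-refl)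

  t≁peg : ∀ {v} → v ∈ D → ¬ Adj G t v
  t≁peg v∈ tv = lonely (_ , v∈ , Adj-sym G tv)

  reachable-or-independent : ∀ {a b w} → a ∈ D → b ∈ D → Adj G a b → Adj G t w → Adj G w a →
                             Reachable G D t ⊎ Independent G (jumped D b a w)
  reachable-or-independent a∈ b∈ ab tw wa = Sum.map₁ reachable (reach₃-or-independent a∈ b∈ ab tw wa)

  EdgesMeet : Fin n → Fin n → Set
  EdgesMeet a b = ∀ {c d} → c ∈ D → d ∈ D → Adj G c d → c ≡ a ⊎ c ≡ b ⊎ d ≡ a ⊎ d ≡ b

  EdgesMeet-swap : ∀ {a b} → EdgesMeet a b → EdgesMeet b a
  EdgesMeet-swap meet c∈ d∈ cd with meet c∈ d∈ cd
  ... | inj₁ c≡a = inj₂ (inj₁ c≡a)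
  ... | inj₂ (inj₁ c≡b) = inj₁ c≡b
  ... | inj₂ (inj₂ (inj₁ d≡a)) = inj₂ (inj₂ (inj₂ d≡a))
  ... | inj₂ (inj₂ (inj₂ d≡b)) = inj₂ (inj₂ (inj₁ d≡b))

  Independent⇒EdgesMeet : ∀ {a b w} → Independent G (jumped D a b w) → EdgesMeet a b
  Independent⇒EdgesMeet {a} {b} ind {c} {d} c∈ d∈ cd with c ≟ a | c ≟ b | d ≟ a | d ≟ b
  ... | yes c≡a | _       | _       | _       = inj₁ c≡a
  ... | no _    | yes c≡b | _       | _       = inj₂ (inj₁ c≡b)
  ... | no _    | no _    | yes d≡a | _       = inj₂ (inj₂ (inj₁ d≡a))
  ... | no _    | no _    | no _    | yes d≡b = inj₂ (inj₂ (inj₂ d≡b))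
  ... | no c≢a  | no c≢b  | no d≢a  | no d≢b  =
    contradiction cd (ind c d (∈-jumped⁺ c∈ c≢a c≢b) (∈-jumped⁺ d∈ d≢a d≢b))

  edges-meet : ∀ {a b} → a ∈ D → b ∈ D → Adj G a b → Reachable G D t ⊎ EdgesMeet a b
  edges-meet a∈ b∈ ab with bridge a∈ b∈ ab
  ... | inj₁ (w , tw , wa) =
    Sum.map₂ (EdgesMeet-swap ∘ Independent⇒EdgesMeet) (reachable-or-independent a∈ b∈ ab tw wa)
  ... | inj₂ (w , tw , wb) =
    Sum.map₂ Independent⇒EdgesMeet (reachable-or-independent b∈ a∈ (Adj-sym G ab) tw wb)

  AvoidingEdge : Fin n → Set
  AvoidingEdge a = ∃[ c ] ∃[ d ] (c ∈ D × d ∈ D × Adj G c d × c ≢ a × d ≢ a)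

  -- otherwise the pegs other than a, together with t, form an independent set of size ∣ D ∣
  avoiding-edge : ∀ {a} → a ∈ D → AvoidingEdge a
  avoiding-edge {a} a∈ with any? (λ c → any? λ d → (c ∈? D) ×-dec (d ∈? D) ×-dec Adj? G c d ×-dec ¬? (c ≟ a) ×-dec ¬? (d ≟ a))
  ... | yes avoiding = avoiding
  ... | no ¬avoiding = ⊥-elim (∣S∣≡∣D∣⇒¬Independent ((D - a) ∪ ⁅ t ⁆) (∣p-x∪⁅y⁆∣≡∣p∣ D a∈ t∉) independent)
    where
    independent : Independent G ((D - a) ∪ ⁅ t ⁆)
    independent x y x∈ y∈ xy with ∈-∪⁅⁆⁻ (D - a) x∈ | ∈-∪⁅⁆⁻ (D - a) y∈
    ... | inj₁ x∈D-a | inj₁ y∈D-a = ¬avoiding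
      (x , y , x∈p-y⇒x∈p x∈D-a , x∈p-y⇒x∈p y∈D-a , xy , x∈p-y⇒x≢y x∈D-a , x∈p-y⇒x≢y y∈D-a)
    ... | inj₁ x∈D-a | inj₂ refl = lonely (x , x∈p-y⇒x∈p x∈D-a , xy)
    ... | inj₂ refl  | inj₁ y∈D-a = t≁peg (x∈p-y⇒x∈p y∈D-a) xy
    ... | inj₂ refl  | inj₂ refl = Adj-irrefl G xy

  other-end : ∀ {a b} → EdgesMeet a b → AvoidingEdge a → ∃[ c ] (c ∈ D × Adj G b c × c ≢ a)
  other-end meet (c , d , c∈ , d∈ , cd , c≢a , d≢a) with meet c∈ d∈ cd
  ... | inj₁ c≡a = contradiction c≡a c≢a
  ... | inj₂ (inj₁ refl) = d , d∈ , cd , d≢a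
  ... | inj₂ (inj₂ (inj₁ d≡a)) = contradiction d≡a d≢a
  ... | inj₂ (inj₂ (inj₂ refl)) = c , c∈ , Adj-sym G cd , c≢a

  record Triangle : Set where
    field
      {v₁ v₂ v₃} : Fin n
      v₁∈ : v₁ ∈ D
      v₂∈ : v₂ ∈ D
      v₃∈ : v₃ ∈ D
      v₁v₂ : Adj G v₁ v₂
      v₁v₃ : Adj G v₁ v₃
      v₂v₃ : Adj G v₂ v₃

  close-triangle : ∀ {a b c e} → a ∈ D → b ∈ D → c ∈ D → Adj G a b → Adj G b c → Adj G a e → c ≢ a → e ≢ b →
                   a ≡ b ⊎ a ≡ c ⊎ e ≡ b ⊎ e ≡ c → Triangle
  close-triangle _ _ _ ab _ _ _ _ (inj₁ refl) = contradiction ab (Adj-irrefl G)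
  close-triangle _ _ _ _ _ _ c≢a _ (inj₂ (inj₁ refl)) = contradiction refl c≢a
  close-triangle _ _ _ _ _ _ _ e≢b (inj₂ (inj₂ (inj₁ e≡b))) = contradiction e≡b e≢b
  close-triangle a∈ b∈ c∈ ab bc ac _ _ (inj₂ (inj₂ (inj₂ refl))) = record
    { v₁∈ = a∈ ; v₂∈ = b∈ ; v₃∈ = c∈ ; v₁v₂ = ab ; v₁v₃ = ac ; v₂v₃ = bc }

  -- a pegged edge ab extends to a pegged triangle abc: some pegged edge avoids a, and it must meet b
  triangle : ∀ {a b} → a ∈ D → b ∈ D → Adj G a b → Reachable G D t ⊎ Triangle
  triangle a∈ b∈ ab = do
    meet ← edges-meet a∈ b∈ ab
    let c , c∈ , bc , c≢a = other-end meet (avoiding-edge a∈)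
        e , e∈ , ae , e≢b = other-end (EdgesMeet-swap meet) (avoiding-edge b∈)
    meet′ ← edges-meet b∈ c∈ bc
    pure (close-triangle a∈ b∈ c∈ ab bc ae c≢a e≢b (meet′ a∈ e∈ ae))

  record Approach : Set where
    field
      {v₁ v₂ v₃ u₁ u₂} : Fin n
      v₁∈ : v₁ ∈ D
      v₂∈ : v₂ ∈ D
      v₃∈ : v₃ ∈ D
      v₁v₂ : Adj G v₁ v₂
      v₁v₃ : Adj G v₁ v₃
      v₂v₃ : Adj G v₂ v₃
      tu₁ : Adj G t u₁
      u₁v₁ : Adj G u₁ v₁
      tu₂ : Adj G t u₂
      u₂v₂ : Adj G u₂ v₂

  corners : ∀ {a b c} → a ∈ D → b ∈ D → c ∈ D → Adj G a b → Adj G a c → Adj G b c → Bridge a → Bridge b → Approach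
  corners a∈ b∈ c∈ ab ac bc (_ , tu₁ , u₁a) (_ , tu₂ , u₂b) = record
    { v₁∈ = a∈ ; v₂∈ = b∈ ; v₃∈ = c∈ ; v₁v₂ = ab ; v₁v₃ = ac ; v₂v₃ = bc ; tu₁ = tu₁ ; u₁v₁ = u₁a ; tu₂ = tu₂ ; u₂v₂ = u₂b }

  -- each edge of the triangle has an endpoint with a bridge, so two corners have one
  approach : Triangle → Approach
  approach record { v₁∈ = v₁∈ ; v₂∈ = v₂∈ ; v₃∈ = v₃∈ ; v₁v₂ = v₁v₂ ; v₁v₃ = v₁v₃ ; v₂v₃ = v₂v₃ }
    with bridge v₁∈ v₂∈ v₁v₂ | bridge v₁∈ v₃∈ v₁v₃ | bridge v₂∈ v₃∈ v₂v₃
  ... | inj₁ b₁ | _      | inj₁ b₂ = corners v₁∈ v₂∈ v₃∈ v₁v₂ v₁v₃ v₂v₃ b₁ b₂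
  ... | inj₁ b₁ | _      | inj₂ b₃ = corners v₁∈ v₃∈ v₂∈ v₁v₃ v₁v₂ (Adj-sym G v₂v₃) b₁ b₃
  ... | inj₂ b₂ | inj₁ b₁ | _     = corners v₁∈ v₂∈ v₃∈ v₁v₂ v₁v₃ v₂v₃ b₁ b₂
  ... | inj₂ b₂ | inj₂ b₃ | _     = corners v₂∈ v₃∈ v₁∈ v₂v₃ (Adj-sym G v₁v₂) (Adj-sym G v₁v₃) b₂ b₃

  Blocking : Fin n → Fin n → Fin n → Fin n → Set
  Blocking v x y u = Independent G (jumped D x v u) × Independent G (jumped D y v u)

  blocking : ∀ {v x y u} → v ∈ D → x ∈ D → y ∈ D → Adj G v x → Adj G v y → Adj G t u → Adj G u v →
             Reachable G D t ⊎ Blocking v x y u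
  blocking v∈ x∈ y∈ vx vy tu uv = do
    ind₁ ← reachable-or-independent v∈ x∈ vx tu uv
    ind₂ ← reachable-or-independent v∈ y∈ vy tu uv
    pure (ind₁ , ind₂)

  bridge-sees-only : ∀ {v x y u} → x ≢ y → Blocking v x y u → ∀ {z} → z ∈ D → z ≢ v → ¬ Adj G u z
  bridge-sees-only {x = x} x≢y (ind₁ , ind₂) {z} z∈ z≢v uz with z ≟ x
  ... | yes refl = ind₂ _ z landing∈jumped (∈-jumped⁺ z∈ x≢y z≢v) uz
  ... | no z≢x = ind₁ _ z landing∈jumped (∈-jumped⁺ z∈ z≢x z≢v) uz

  -- otherwise, after jumping q over p onto w, adding w′ gives an independent set of size ∣ D ∣
  bridges-adjacent : ∀ {p q w w′} → p ∈ D → q ∈ D → Adj G p q →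
                     Adj G t w → Adj G w p → Independent G (jumped D q p w) →
                     Adj G t w′ → Adj G w′ q → (∀ {z} → z ∈ D → z ≢ q → ¬ Adj G w′ z) → Adj G w w′
  bridges-adjacent {p} {q} {w} {w′} p∈ q∈ pq tw wp ind tw′ w′q w′-only with Adj? G w w′
  ... | yes ww′ = ww′
  ... | no w≁w′ = ⊥-elim (∣S∣≡∣D∣⇒¬Independent I ∣I∣≡∣D∣ I-independent)
    where
    J = jumped D q p w
    I = J ∪ ⁅ w′ ⁆
    w′∉J : w′ ∉ J
    w′∉J = ∉-jumped (bridge∉ tw′) λ { refl → w′-only p∈ (Adj⇒≢ G pq) wp }
    ∣I∣≡∣D∣ : ∣ I ∣ ≡ ∣ D ∣
    ∣I∣≡∣D∣ = trans (x∉p⇒∣p∪⁅x⁆∣≡suc∣p∣ J w′ w′∉J) (suc∣jumped∣≡∣D∣ q∈ p∈ (Adj⇒≢ G pq) (bridge∉ tw))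
    w′-isolated : ∀ {y} → y ∈ J → ¬ Adj G w′ y
    w′-isolated y∈ w′y with ∈-jumped⁻ y∈
    ... | inj₁ (y∈D , y≢q , _) = w′-only y∈D y≢q w′y
    ... | inj₂ refl = w≁w′ (Adj-sym G w′y)
    I-independent : Independent G I
    I-independent x y x∈ y∈ xy with ∈-∪⁅⁆⁻ J x∈ | ∈-∪⁅⁆⁻ J y∈
    ... | inj₁ x∈J | inj₁ y∈J = ind x y x∈J y∈J xy
    ... | inj₁ x∈J | inj₂ refl = w′-isolated x∈J (Adj-sym G xy)
    ... | inj₂ refl | inj₁ y∈J = w′-isolated y∈J xy
    ... | inj₂ refl | inj₂ refl = Adj-irrefl G xy

  contains-A : Approach → Reachable G D t ⊎ Contains G graphᴬ
  contains-A record { v₁∈ = v₁∈ ; v₂∈ = v₂∈ ; v₃∈ = v₃∈ ; v₁v₂ = v₁v₂ ; v₁v₃ = v₁v₃ ; v₂v₃ = v₂v₃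
                    ; tu₁ = tu₁ ; u₁v₁ = u₁v₁ ; tu₂ = tu₂ ; u₂v₂ = u₂v₂ } = do
    block₁ ← blocking v₁∈ v₂∈ v₃∈ v₁v₂ v₁v₃ tu₁ u₁v₁
    block₂ ← blocking v₂∈ v₁∈ v₃∈ (Adj-sym G v₁v₂) v₂v₃ tu₂ u₂v₂
    let u₁-only = bridge-sees-only (Adj⇒≢ G v₂v₃) block₁
        u₂-only = bridge-sees-only (Adj⇒≢ G v₁v₃) block₂
        u₁u₂ = bridges-adjacent v₁∈ v₂∈ v₁v₂ tu₁ u₁v₁ (proj₁ block₁) tu₂ u₂v₂ u₂-only
        v₂≢v₁ = Adj⇒≢ G (Adj-sym G v₁v₂)
        v₃≢v₁ = Adj⇒≢ G (Adj-sym G v₁v₃)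
        v₃≢v₂ = Adj⇒≢ G (Adj-sym G v₂v₃)
    pure (_ ,
        (edge tu₁ ∷ edge tu₂ ∷ non-edge (t≁peg v₁∈) ∷ non-edge (t≁peg v₂∈) ∷ non-edge (t≁peg v₃∈) ∷ [])
      ◂ (edge u₁u₂ ∷ edge u₁v₁ ∷ non-edge (u₁-only v₂∈ v₂≢v₁) ∷ non-edge (u₁-only v₃∈ v₃≢v₁) ∷ [])
      ◂ (non-edge (u₂-only v₁∈ (Adj⇒≢ G v₁v₂)) ∷ edge u₂v₂ ∷ non-edge (u₂-only v₃∈ v₃≢v₂) ∷ [])
      ◂ (edge v₁v₂ ∷ edge v₁v₃ ∷ [])
      ◂ (edge v₂v₃ ∷ [])
      ◂ []
      ◂ ∅)

  contains-B : DiamBound G 2 → Approach → Reachable G D t ⊎ Contains G graphᴮ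
  contains-B diam record { v₁∈ = v₁∈ ; v₂∈ = v₂∈ ; v₃∈ = v₃∈ ; v₁v₂ = v₁v₂ ; v₁v₃ = v₁v₃ ; v₂v₃ = v₂v₃
                         ; tu₁ = tu₁ ; u₁v₁ = u₁v₁ ; tu₂ = tu₂ ; u₂v₂ = u₂v₂ } = do
    let _ , tu₃ , u₃v₃ = bridge-to v₃∈ (diam t _)
    block₁ ← blocking v₁∈ v₂∈ v₃∈ v₁v₂ v₁v₃ tu₁ u₁v₁
    block₂ ← blocking v₂∈ v₁∈ v₃∈ (Adj-sym G v₁v₂) v₂v₃ tu₂ u₂v₂
    block₃ ← blocking v₃∈ v₁∈ v₂∈ (Adj-sym G v₁v₃) (Adj-sym G v₂v₃) tu₃ u₃v₃
    let u₁-only = bridge-sees-only (Adj⇒≢ G v₂v₃) block₁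
        u₂-only = bridge-sees-only (Adj⇒≢ G v₁v₃) block₂
        u₃-only = bridge-sees-only (Adj⇒≢ G v₁v₂) block₃
        u₁u₂ = bridges-adjacent v₁∈ v₂∈ v₁v₂ tu₁ u₁v₁ (proj₁ block₁) tu₂ u₂v₂ u₂-only
        u₁u₃ = bridges-adjacent v₁∈ v₃∈ v₁v₃ tu₁ u₁v₁ (proj₂ block₁) tu₃ u₃v₃ u₃-only
        u₂u₃ = bridges-adjacent v₂∈ v₃∈ v₂v₃ tu₂ u₂v₂ (proj₂ block₂) tu₃ u₃v₃ u₃-only
        v₂≢v₁ = Adj⇒≢ G (Adj-sym G v₁v₂)
        v₃≢v₁ = Adj⇒≢ G (Adj-sym G v₁v₃)
        v₃≢v₂ = Adj⇒≢ G (Adj-sym G v₂v₃)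
    pure (_ ,
        (edge tu₁ ∷ edge tu₂ ∷ non-edge (t≁peg v₁∈) ∷ non-edge (t≁peg v₂∈) ∷ non-edge (t≁peg v₃∈) ∷ edge tu₃ ∷ [])
      ◂ (edge u₁u₂ ∷ edge u₁v₁ ∷ non-edge (u₁-only v₂∈ v₂≢v₁) ∷ non-edge (u₁-only v₃∈ v₃≢v₁) ∷ edge u₁u₃ ∷ [])
      ◂ (non-edge (u₂-only v₁∈ (Adj⇒≢ G v₁v₂)) ∷ edge u₂v₂ ∷ non-edge (u₂-only v₃∈ v₃≢v₂) ∷ edge u₂u₃ ∷ [])
      ◂ (edge v₁v₂ ∷ edge v₁v₃ ∷ non-edge (u₃-only v₁∈ (Adj⇒≢ G v₁v₃) ∘ Adj-sym G) ∷ [])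
      ◂ (edge v₂v₃ ∷ non-edge (u₃-only v₂∈ (Adj⇒≢ G v₂v₃) ∘ Adj-sym G) ∷ [])
      ◂ (edge (Adj-sym G u₃v₃) ∷ [])
      ◂ []
      ◂ ∅)

module PeggingNumber {n : ℕ} (G : Graph n) (ve : VEBound G 2) {α : ℕ} (bound : IndepBound G α) where
  open Pegging G
  open VertexEdgeDiameter≤2 G ve

  PegNum≤α+2 : ∀ p → PegNum G p → p ≤ α + 2
  PegNum≤α+2 p (_ , _ , minimal) = ≮⇒≥ λ α+2<p → minimal (α + 2) (≤-trans (s≤s z≤n) (m≤n+m 2 α)) α+2<p
    λ D ∣D∣≡α+2 t → reachable (reach-within-3 bound D (≤-reflexive (sym ∣D∣≡α+2)) t)

  reachable-or : ∀ {X : Set} →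
                 (∀ {D t} (∣D∣≡1+α : ∣ D ∣ ≡ suc α) (t∉ : t ∉ D) (lonely : ¬ PeggedNeighbour D t) →
                  Extremal.Approach G ve bound ∣D∣≡1+α t∉ lonely → Reachable G D t ⊎ X) →
                 ∀ D → ∣ D ∣ ≡ suc α → ∀ t → Reachable G D t ⊎ X
  reachable-or extend D ∣D∣≡1+α t with t ∈? D
  ... | yes t∈ = inj₁ (reachable (reach-now {m = 0} t∈))
  ... | no t∉ with hasEdge? D
  ...   | no ¬e = ⊥-elim (large⇒¬Independent G bound D (≤-reflexive (sym ∣D∣≡1+α)) (¬HasEdge⇒Independent ¬e))
  ...   | yes (a , b , a∈ , b∈ , ab) with peggedNeighbour? D t
  ...     | yes (y , y∈ , yt) = inj₁ (reachable (reach₂-from-peggedNeighbour t∉ y∈ yt a∈ b∈ ab))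
  ...     | no lonely = Sum.[ inj₁ , extend ∣D∣≡1+α t∉ lonely ∘ approach ]′ (triangle a∈ b∈ ab)
    where open Extremal G ve bound ∣D∣≡1+α t∉ lonely

  -- if X failed, every distribution of α + 1 pegs would reach everything, against P(G) = α + 2
  extremal-witness : ∀ {X : Set} → Dec X → PegNum G (α + 2) → (∀ D → ∣ D ∣ ≡ suc α → ∀ t → Reachable G D t ⊎ X) → X
  extremal-witness (yes x) _ _ = x
  extremal-witness (no ¬x) (_ , _ , minimal) reachable-or-x =
    ⊥-elim (minimal (α + 1) (m≤n+m 1 α) (+-monoʳ-< α (n<1+n 1)) λ D ∣D∣≡α+1 t →
      Sum.[ id , flip contradiction ¬x ]′ (reachable-or-x D (trans ∣D∣≡α+1 (+-comm α 1)) t))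

  PegNum≡α+2⇒A : PegNum G (α + 2) → InducedSub graphA G
  PegNum≡α+2⇒A P≡α+2 = Contains⇒InducedSub graphᴬ graphᴬ-twinFree (extremal-witness (contains? G graphᴬ) P≡α+2
    (reachable-or λ ∣D∣≡1+α t∉ lonely → Extremal.contains-A G ve bound ∣D∣≡1+α t∉ lonely))

  PegNum≡α+2⇒B : PegNum G (α + 2) → DiamBound G 2 → InducedSub graphB G
  PegNum≡α+2⇒B P≡α+2 diam = Contains⇒InducedSub graphᴮ graphᴮ-twinFree (extremal-witness (contains? G graphᴮ) P≡α+2
    (reachable-or λ ∣D∣≡1+α t∉ lonely → Extremal.contains-B G ve bound ∣D∣≡1+α t∉ lonely diam))

-- A graph of diameter 2 with α = k + 2 and P = k + 4

module Example (k : ℕ) where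

  data Label : Set where
    hub : Label
    tri : Fin 3 → Label
    leaf : Fin k → Label

  data Vertex : Set where
    target : Vertex
    outer inner : Label → Vertex

  L : ℕ
  L = suc (3 + k)

  labelIndex : Label → Fin L
  labelIndex hub = zero
  labelIndex (tri i) = suc (i ↑ˡ k)
  labelIndex (leaf j) = suc (3 ↑ʳ j)

  labelAt : Fin L → Label
  labelAt zero = hub
  labelAt (suc x) = [ tri , leaf ]′ (splitAt 3 x)

  labelAt-index : ∀ l → labelAt (labelIndex l) ≡ l
  labelAt-index hub = refl
  labelAt-index (tri i) = cong [ tri , leaf ]′ (splitAt-↑ˡ 3 i k)
  labelAt-index (leaf j) = cong [ tri , leaf ]′ (splitAt-↑ʳ 3 k j)

  index-labelAt : ∀ x → labelIndex (labelAt x) ≡ x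
  index-labelAt zero = refl
  index-labelAt (suc x) with splitAt 3 x in eq
  ... | inj₁ i = cong suc (splitAt⁻¹-↑ˡ eq)
  ... | inj₂ j = cong suc (splitAt⁻¹-↑ʳ eq)

  N : ℕ
  N = suc (L + L)

  index : Vertex → Fin N
  index target = zero
  index (outer l) = suc (labelIndex l ↑ˡ L)
  index (inner l) = suc (L ↑ʳ labelIndex l)

  vertexAt : Fin N → Vertex
  vertexAt zero = target
  vertexAt (suc x) = [ outer ∘ labelAt , inner ∘ labelAt ]′ (splitAt L x)

  vertexAt-index : ∀ a → vertexAt (index a) ≡ a
  vertexAt-index target = refl
  vertexAt-index (outer l) = trans (cong [ outer ∘ labelAt , inner ∘ labelAt ]′ (splitAt-↑ˡ L (labelIndex l) L))
                                   (cong outer (labelAt-index l))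
  vertexAt-index (inner l) = trans (cong [ outer ∘ labelAt , inner ∘ labelAt ]′ (splitAt-↑ʳ L L (labelIndex l)))
                                   (cong inner (labelAt-index l))

  index-vertexAt : ∀ x → index (vertexAt x) ≡ x
  index-vertexAt zero = refl
  index-vertexAt (suc x) with splitAt L x in eq
  ... | inj₁ y = cong suc (trans (cong (_↑ˡ L) (index-labelAt y)) (splitAt⁻¹-↑ˡ eq))
  ... | inj₂ y = cong suc (trans (cong (L ↑ʳ_) (index-labelAt y)) (splitAt⁻¹-↑ʳ eq))

  index-injective : ∀ {a b} → index a ≡ index b → a ≡ b
  index-injective {a} {b} eq = trans (sym (vertexAt-index a)) (trans (cong vertexAt eq) (vertexAt-index b))

  _≟ℓ_ : DecidableEquality Label
  l ≟ℓ m = map′ (λ eq → trans (sym (labelAt-index l)) (trans (cong labelAt eq) (labelAt-index m))) (cong labelIndex)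
                (labelIndex l ≟ labelIndex m)

  -- Each edge is listed in one orientation only. The early `false` clauses make `arc` compute
  -- when only the constructors of its arguments, not their labels, are known.
  arc : Vertex → Vertex → Bool
  arc target (outer _) = true
  arc target _ = false
  arc (outer l) (inner m) = ⌊ l ≟ℓ m ⌋
  arc (outer _) target = false
  arc (outer hub) (outer (tri _)) = true
  arc (outer (tri i)) (outer (tri j)) = not ⌊ i ≟ j ⌋
  arc (outer (tri _)) (outer (leaf _)) = true
  arc (outer (leaf i)) (outer (leaf j)) = not ⌊ i ≟ j ⌋
  arc (outer _) (outer _) = false
  arc (inner _) target = false
  arc (inner _) (outer _) = false
  arc (inner hub) (inner (tri _)) = true
  arc (inner hub) (inner (leaf _)) = true
  arc (inner (tri i)) (inner (tri j)) = not ⌊ i ≟ j ⌋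
  arc (inner _) (inner _) = false

  adjacent : Vertex → Vertex → Bool
  adjacent a b = arc a b ∨ arc b a

  arc-irrefl : ∀ a → arc a a ≡ false
  arc-irrefl target = refl
  arc-irrefl (outer hub) = refl
  arc-irrefl (outer (tri i)) = cong not (edge (fromWitness {a? = i ≟ i} refl))
  arc-irrefl (outer (leaf j)) = cong not (edge (fromWitness {a? = j ≟ j} refl))
  arc-irrefl (inner hub) = refl
  arc-irrefl (inner (tri i)) = cong not (edge (fromWitness {a? = i ≟ i} refl))
  arc-irrefl (inner (leaf j)) = refl

  G : Graph N
  G = record
    { adj = λ x y → adjacent (vertexAt x) (vertexAt y)
    ; sym = λ x y → Bool.∨-comm (arc (vertexAt x) (vertexAt y)) _
    ; irref = λ x → cong (λ b → b ∨ b) (arc-irrefl (vertexAt x))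
    }

  Adj-index : ∀ {a b} → T (adjacent a b) → Adj G (index a) (index b)
  Adj-index {a} {b} = subst₂ (λ a′ b′ → T (adjacent a′ b′)) (sym (vertexAt-index a)) (sym (vertexAt-index b))

  index-Adj : ∀ {a b} → Adj G (index a) (index b) → T (adjacent a b)
  index-Adj {a} {b} = subst₂ (λ a′ b′ → T (adjacent a′ b′)) (vertexAt-index a) (vertexAt-index b)

  arc⇒adjacent : ∀ a b → T (arc a b) → T (adjacent a b)
  arc⇒adjacent a b p = Equivalence.from (T-∨ {arc a b} {arc b a}) (inj₁ p)

  adjacent⇒arc : ∀ a b → T (adjacent a b) → T (arc a b) ⊎ T (arc b a)
  adjacent⇒arc a b = Equivalence.to (T-∨ {arc a b} {arc b a})

  partner : ∀ l → T (adjacent (outer l) (inner l))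
  partner l = arc⇒adjacent (outer l) (inner l) (fromWitness {a? = l ≟ℓ l} refl)

  partner˘ : ∀ l → T (adjacent (inner l) (outer l))
  partner˘ l = fromWitness {a? = l ≟ℓ l} refl

  partner-unique : ∀ {l m} → T (adjacent (outer l) (inner m)) → l ≡ m
  partner-unique {l} {m} l~m with adjacent⇒arc (outer l) (inner m) l~m
  ... | inj₁ p = toWitness p
  ... | inj₂ ()

  tris-adjacent : ∀ {i j} → i ≢ j → T (adjacent (inner (tri i)) (inner (tri j)))
  tris-adjacent {i} {j} i≢j = arc⇒adjacent (inner (tri i)) (inner (tri j)) (fromWitnessFalse i≢j)

  leaves-adjacent : ∀ {i j} → i ≢ j → T (adjacent (outer (leaf i)) (outer (leaf j)))
  leaves-adjacent {i} {j} i≢j = arc⇒adjacent (outer (leaf i)) (outer (leaf j)) (fromWitnessFalse i≢j)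

  outer-tris-adjacent : ∀ {i j} → i ≢ j → T (adjacent (outer (tri i)) (outer (tri j)))
  outer-tris-adjacent {i} {j} i≢j = arc⇒adjacent (outer (tri i)) (outer (tri j)) (fromWitnessFalse i≢j)

  Within2 : Vertex → Vertex → Set
  Within2 a b = T (adjacent a b) ⊎ ∃[ c ] (T (adjacent a c) × T (adjacent c b))

  Within2-sym : ∀ {a b} → Within2 a b → Within2 b a
  Within2-sym {a} {b} (inj₁ ab) = inj₁ (subst T (Bool.∨-comm (arc a b) (arc b a)) ab)
  Within2-sym {a} {b} (inj₂ (c , ac , cb)) =
    inj₂ (c , subst T (Bool.∨-comm (arc c b) (arc b c)) cb , subst T (Bool.∨-comm (arc a c) (arc c a)) ac)

  outer-within2-inner : ∀ l m → Within2 (outer l) (inner m)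
  outer-within2-inner hub hub = inj₁ (partner hub)
  outer-within2-inner hub (tri j) = inj₂ (outer (tri j) , tt , partner (tri j))
  outer-within2-inner hub (leaf j) = inj₂ (inner hub , partner hub , tt)
  outer-within2-inner (tri i) hub = inj₂ (outer hub , tt , partner hub)
  outer-within2-inner (tri i) (tri j) = tris (i ≟ j)
    where
    tris : Dec (i ≡ j) → Within2 (outer (tri i)) (inner (tri j))
    tris (yes refl) = inj₁ (partner (tri i))
    tris (no i≢j) = inj₂ (inner (tri i) , partner (tri i) , tris-adjacent i≢j)
  outer-within2-inner (tri i) (leaf j) = inj₂ (outer (leaf j) , tt , partner (leaf j))
  outer-within2-inner (leaf i) hub = inj₂ (inner (leaf i) , partner (leaf i) , tt)
  outer-within2-inner (leaf i) (tri j) = inj₂ (outer (tri j) , tt , partner (tri j))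
  outer-within2-inner (leaf i) (leaf j) = leaves (i ≟ j)
    where
    leaves : Dec (i ≡ j) → Within2 (outer (leaf i)) (inner (leaf j))
    leaves (yes refl) = inj₁ (partner (leaf i))
    leaves (no i≢j) = inj₂ (outer (leaf j) , leaves-adjacent i≢j , partner (leaf j))

  inner-within2-inner : ∀ l m → Within2 (inner l) (inner m)
  inner-within2-inner hub hub = inj₂ (inner (tri zero) , tt , tt)
  inner-within2-inner hub (tri _) = inj₁ tt
  inner-within2-inner hub (leaf _) = inj₁ tt
  inner-within2-inner (tri _) hub = inj₁ tt
  inner-within2-inner (leaf _) hub = inj₁ tt
  inner-within2-inner (tri _) (tri _) = inj₂ (inner hub , tt , tt)
  inner-within2-inner (tri _) (leaf _) = inj₂ (inner hub , tt , tt)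
  inner-within2-inner (leaf _) (tri _) = inj₂ (inner hub , tt , tt)
  inner-within2-inner (leaf _) (leaf _) = inj₂ (inner hub , tt , tt)

  within2 : ∀ a b → Within2 a b
  within2 target target = inj₂ (outer hub , tt , tt)
  within2 target (outer _) = inj₁ tt
  within2 target (inner l) = inj₂ (outer l , tt , partner l)
  within2 (outer _) target = inj₁ tt
  within2 (outer _) (outer _) = inj₂ (target , tt , tt)
  within2 (outer l) (inner m) = outer-within2-inner l m
  within2 (inner l) target = inj₂ (outer l , partner˘ l , tt)
  within2 (inner l) (outer m) = Within2-sym (outer-within2-inner m l)
  within2 (inner l) (inner m) = inner-within2-inner l m

  diameter≤2 : DiamBound G 2
  diameter≤2 x y with within2 (vertexAt x) (vertexAt y)
  ... | inj₁ xy = 1 , s≤s z≤n , step xy here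
  ... | inj₂ (c , xc , cy) = 2 , ≤-refl ,
    step {y = index c} (subst (T ∘ adjacent (vertexAt x)) (sym (vertexAt-index c)) xc)
         (step (subst (λ c′ → T (adjacent c′ (vertexAt y))) (sym (vertexAt-index c)) cy) here)

  target-far-from-tri : ∀ {m} i → m ≤ 1 → ¬ DistLe G (index target) (index (inner (tri i))) m
  target-far-from-tri i m≤1 d with DistLe≤1-view G d m≤1
  ... | inj₁ ()
  ... | inj₂ t~v = index-Adj {target} {inner (tri i)} t~v

  diameter≥2 : ∀ m → DiamBound G m → 2 ≤ m
  diameter≥2 m diam = ≰⇒> λ m≤1 → target-far-from-tri zero m≤1 (diam (index target) (index (inner (tri zero))))

  VEDiam≡2 : VEDiam G 2
  VEDiam≡2 = (index target , index (outer hub) , Adj-index {target} {outer hub} tt) , (λ x u v _ → inj₁ (diameter≤2 x u)) ,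
    λ m bound → ≰⇒> λ m≤1 → Sum.[ target-far-from-tri zero m≤1 , target-far-from-tri (suc zero) m≤1 ]′
      (bound (index target) (index (inner (tri zero))) (index (inner (tri (suc zero)))) (Adj-index {inner (tri zero)} {inner (tri (suc zero))} (tris-adjacent {zero} {suc zero} λ ())))

  data InClique : Fin (2 + k) → Vertex → Set where
    target : InClique zero target
    outer-hub : InClique zero (outer hub)
    outer-tri : ∀ i → InClique zero (outer (tri i))
    inner-hub : InClique (suc zero) (inner hub)
    inner-tri : ∀ i → InClique (suc zero) (inner (tri i))
    outer-leaf : ∀ j → InClique (suc (suc j)) (outer (leaf j))
    inner-leaf : ∀ j → InClique (suc (suc j)) (inner (leaf j))

  clique : Vertex → Fin (2 + k)
  clique target = zero
  clique (outer hub) = zero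
  clique (outer (tri _)) = zero
  clique (inner hub) = suc zero
  clique (inner (tri _)) = suc zero
  clique (outer (leaf j)) = suc (suc j)
  clique (inner (leaf j)) = suc (suc j)

  inClique : ∀ a → InClique (clique a) a
  inClique target = target
  inClique (outer hub) = outer-hub
  inClique (outer (tri i)) = outer-tri i
  inClique (inner hub) = inner-hub
  inClique (inner (tri i)) = inner-tri i
  inClique (outer (leaf j)) = outer-leaf j
  inClique (inner (leaf j)) = inner-leaf j

  same-clique : ∀ {c a b} → InClique c a → InClique c b → a ≡ b ⊎ T (adjacent a b)
  same-clique target target = inj₁ refl
  same-clique target outer-hub = inj₂ tt
  same-clique target (outer-tri _) = inj₂ tt
  same-clique outer-hub target = inj₂ tt
  same-clique outer-hub outer-hub = inj₁ refl
  same-clique outer-hub (outer-tri _) = inj₂ tt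
  same-clique (outer-tri _) target = inj₂ tt
  same-clique (outer-tri _) outer-hub = inj₂ tt
  same-clique (outer-tri i) (outer-tri j) = Sum.map (cong (outer ∘ tri)) outer-tris-adjacent (toSum (i ≟ j))
  same-clique inner-hub inner-hub = inj₁ refl
  same-clique inner-hub (inner-tri _) = inj₂ tt
  same-clique (inner-tri _) inner-hub = inj₂ tt
  same-clique (inner-tri i) (inner-tri j) = Sum.map (cong (inner ∘ tri)) tris-adjacent (toSum (i ≟ j))
  same-clique (outer-leaf j) (outer-leaf j) = inj₁ refl
  same-clique (outer-leaf j) (inner-leaf j) = inj₂ (partner (leaf j))
  same-clique (inner-leaf j) (outer-leaf j) = inj₂ (partner˘ (leaf j))
  same-clique (inner-leaf j) (inner-leaf j) = inj₁ refl

  α≤k+2 : IndepBound G (2 + k)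
  α≤k+2 S independent = subst (∣ S ∣ ≤_) (∣⊤∣≡n (2 + k))
    (injectiveOn⇒∣p∣≤∣q∣ S ⊤ (clique ∘ vertexAt) (λ _ → ∈⊤) λ {x} {y} x∈ y∈ eq →
      case same-clique (inClique (vertexAt x)) (subst (λ c → InClique c (vertexAt y)) (sym eq) (inClique (vertexAt y))) of λ
        { (inj₁ x≡y) → trans (sym (index-vertexAt x)) (trans (cong index x≡y) (index-vertexAt y))
        ; (inj₂ x~y) → contradiction x~y (independent x y x∈ y∈) })

  spread : Fin (2 + k) → Vertex
  spread zero = target
  spread (suc zero) = inner (tri zero)
  spread (suc (suc j)) = inner (leaf j)

  clique∘spread : ∀ i → clique (spread i) ≡ i
  clique∘spread zero = refl
  clique∘spread (suc zero) = refl
  clique∘spread (suc (suc j)) = refl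

  spread-nonadjacent : ∀ i j → ¬ T (adjacent (spread i) (spread j))
  spread-nonadjacent zero zero ()
  spread-nonadjacent zero (suc zero) ()
  spread-nonadjacent zero (suc (suc _)) ()
  spread-nonadjacent (suc zero) zero ()
  spread-nonadjacent (suc zero) (suc zero) ()
  spread-nonadjacent (suc zero) (suc (suc _)) ()
  spread-nonadjacent (suc (suc _)) zero ()
  spread-nonadjacent (suc (suc _)) (suc zero) ()
  spread-nonadjacent (suc (suc _)) (suc (suc _)) ()

  α≡k+2 : IndepNum G (2 + k)
  α≡k+2 = (image (index ∘ spread) , independent , ≤-antisym (α≤k+2 _ independent) (injective⇒m≤∣image∣ injective)) , α≤k+2
    where
    injective : Injective _≡_ _≡_ (index ∘ spread)
    injective {i} {j} eq = trans (sym (clique∘spread i)) (trans (cong clique (index-injective eq)) (clique∘spread j))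
    independent : Independent G (image (index ∘ spread))
    independent x y x∈ y∈ with ∈-image⁻ x∈ | ∈-image⁻ y∈
    ... | i , refl | j , refl = spread-nonadjacent i j ∘ index-Adj {spread i} {spread j}

  ⟨_⟩ : Label → Fin N
  ⟨ l ⟩ = index (inner l)

  data InnerEdge : Label → Label → Set where
    from-hub : ∀ {l} → InnerEdge hub l
    to-hub : ∀ {l} → InnerEdge l hub
    tri-tri : ∀ {i j} → i ≢ j → InnerEdge (tri i) (tri j)

  innerEdge : ∀ l m → T (adjacent (inner l) (inner m)) → InnerEdge l m
  innerEdge hub _ _ = from-hub
  innerEdge (tri _) hub _ = to-hub
  innerEdge (leaf _) hub _ = to-hub
  innerEdge (tri i) (tri j) e with adjacent⇒arc (inner (tri i)) (inner (tri j)) e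
  ... | inj₁ i≢j = tri-tri (toWitnessFalse i≢j)
  ... | inj₂ j≢i = tri-tri (toWitnessFalse j≢i ∘ sym)
  innerEdge (tri _) (leaf _) ()
  innerEdge (leaf _) (tri _) ()
  innerEdge (leaf _) (leaf _) ()

  inner-neighbour : ∀ l c → T (adjacent (inner l) c) → (∃[ m ] c ≡ inner m) ⊎ c ≡ outer l
  inner-neighbour l target ()
  inner-neighbour l (outer m) l~m = inj₂ (cong outer (partner-unique {m} {l} (subst T (Bool.∨-comm (arc (inner l) (outer m)) _) l~m)))
  inner-neighbour l (inner m) _ = inj₁ (m , refl)

  three-tris : ∀ (a b c d : Fin 3) → a ≢ b → c ≢ a → c ≢ b → d ≢ a → d ≢ b → c ≡ d
  three-tris = toWitness {a? = all? λ a → all? λ b → all? λ c → all? λ d →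
    ¬? (a ≟ b) →-dec ¬? (c ≟ a) →-dec ¬? (c ≟ b) →-dec ¬? (d ≟ a) →-dec ¬? (d ≟ b) →-dec c ≟ d} tt

  Confined : Subset N → Set
  Confined D = (∀ {x} → x ∈ D → ∃[ l ] x ≡ ⟨ l ⟩)
             × (⟨ hub ⟩ ∈ D → ∀ {i j} → ⟨ tri i ⟩ ∈ D → ⟨ tri j ⟩ ∈ D → i ≡ j)

  Stuck : Subset N → Set
  Stuck D = Independent G D × index target ∉ D

  Safe : Subset N → Set
  Safe D = Confined D ⊎ Stuck D

  ⟨⟩-injective : ∀ {l m} → ⟨ l ⟩ ≡ ⟨ m ⟩ → l ≡ m
  ⟨⟩-injective {l} {m} eq with index-injective {inner l} {inner m} eq
  ... | refl = refl

  ⟨⟩≢ : ∀ {l m} → ⟨ l ⟩ ≢ ⟨ m ⟩ → l ≢ m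
  ⟨⟩≢ ne l≡m = ne (cong ⟨_⟩ l≡m)

  tri≢ : ∀ {i j} → tri i ≢ tri j → i ≢ j
  tri≢ ne i≡j = ne (cong tri i≡j)

  disjoint-edges : ∀ {D} → Confined D → ∀ {a b p q} → ⟨ a ⟩ ∈ D → ⟨ b ⟩ ∈ D → ⟨ p ⟩ ∈ D → ⟨ q ⟩ ∈ D →
                   InnerEdge a b → InnerEdge p q → p ≢ a → p ≢ b → q ≢ a → q ≢ b → Data.Empty.⊥
  disjoint-edges _ _ _ _ _ from-hub from-hub p≢a _ _ _ = p≢a refl
  disjoint-edges _ _ _ _ _ from-hub to-hub _ _ q≢a _ = q≢a refl
  disjoint-edges _ _ _ _ _ to-hub from-hub _ p≢b _ _ = p≢b refl
  disjoint-edges _ _ _ _ _ to-hub to-hub _ _ _ q≢b = q≢b refl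
  disjoint-edges (_ , hub-alone) a∈ _ p∈ q∈ from-hub (tri-tri p≢q) _ _ _ _ = p≢q (hub-alone a∈ p∈ q∈)
  disjoint-edges (_ , hub-alone) _ b∈ p∈ q∈ to-hub (tri-tri p≢q) _ _ _ _ = p≢q (hub-alone b∈ p∈ q∈)
  disjoint-edges (_ , hub-alone) a∈ b∈ p∈ _ (tri-tri a≢b) from-hub _ _ _ _ = a≢b (hub-alone p∈ a∈ b∈)
  disjoint-edges (_ , hub-alone) a∈ b∈ _ q∈ (tri-tri a≢b) to-hub _ _ _ _ = a≢b (hub-alone q∈ a∈ b∈)
  disjoint-edges _ _ _ _ _ (tri-tri {a} {b} a≢b) (tri-tri {p} {q} p≢q) p≢a p≢b q≢a q≢b =
    p≢q (three-tris a b p q a≢b (tri≢ p≢a) (tri≢ p≢b) (tri≢ q≢a) (tri≢ q≢b))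

  -- a jump inside the inner part either removes the pegged hub or lands on it after using up two tris
  jump-inside : ∀ {D a b c} → Confined D → ⟨ a ⟩ ∈ D → ⟨ b ⟩ ∈ D → InnerEdge a b → ⟨ c ⟩ ∉ D →
                Confined (jumped D ⟨ a ⟩ ⟨ b ⟩ ⟨ c ⟩)
  jump-inside {D} {a} {b} {c} (inner-pegs , hub-alone) a∈ b∈ ab c∉ = inner-pegs′ , hub-alone′ ab
    where
    D′ = jumped D ⟨ a ⟩ ⟨ b ⟩ ⟨ c ⟩
    ∈D′⁻ : ∀ {x} → x ∈ D′ → (x ∈ D × x ≢ ⟨ a ⟩ × x ≢ ⟨ b ⟩) ⊎ x ≡ ⟨ c ⟩
    ∈D′⁻ = ∈-jumped⁻ {D = D}
    inner-pegs′ : ∀ {x} → x ∈ D′ → ∃[ l ] x ≡ ⟨ l ⟩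
    inner-pegs′ x∈ with ∈D′⁻ x∈
    ... | inj₁ (x∈D , _) = inner-pegs x∈D
    ... | inj₂ x≡c = c , x≡c
    tri≢c : ∀ {i} → c ≡ hub → ⟨ tri i ⟩ ≢ ⟨ c ⟩
    tri≢c {i} refl eq = case ⟨⟩-injective {tri i} {hub} eq of λ ()
    tri∈D′⇒≢ : ∀ {i} → c ≡ hub → ⟨ tri i ⟩ ∈ D′ → tri i ≢ a × tri i ≢ b
    tri∈D′⇒≢ c≡hub i∈ with ∈D′⁻ i∈
    ... | inj₁ (_ , i≢a , i≢b) = ⟨⟩≢ i≢a , ⟨⟩≢ i≢b
    ... | inj₂ eq = contradiction eq (tri≢c c≡hub)
    hub-alone′ : InnerEdge a b → ⟨ hub ⟩ ∈ D′ → ∀ {i j} → ⟨ tri i ⟩ ∈ D′ → ⟨ tri j ⟩ ∈ D′ → i ≡ j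
    hub-alone′ ab hub∈ with ∈D′⁻ hub∈ | ab
    ... | inj₁ (_ , hub≢a , _) | from-hub = contradiction refl hub≢a
    ... | inj₁ (_ , _ , hub≢b) | to-hub = contradiction refl hub≢b
    ... | inj₁ (hub∈D , _) | tri-tri a≢b = contradiction (hub-alone hub∈D a∈ b∈) a≢b
    ... | inj₂ hub≡c | from-hub = contradiction (subst (_∈ D) hub≡c a∈) c∉
    ... | inj₂ hub≡c | to-hub = contradiction (subst (_∈ D) hub≡c b∈) c∉
    ... | inj₂ hub≡c | tri-tri {a} {b} a≢b = λ i∈ j∈ →
      let c≡hub = sym (⟨⟩-injective hub≡c)
          i≢a , i≢b = tri∈D′⇒≢ c≡hub i∈
          j≢a , j≢b = tri∈D′⇒≢ c≡hub j∈
      in three-tris a b _ _ a≢b (tri≢ i≢a) (tri≢ i≢b) (tri≢ j≢a) (tri≢ j≢b)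

  -- the only inner neighbour of the landing vertex has just been removed, and pegged inner edges pairwise meet
  jump-outside : ∀ {D a b} → Confined D → ⟨ a ⟩ ∈ D → ⟨ b ⟩ ∈ D → InnerEdge a b →
                 Stuck (jumped D ⟨ a ⟩ ⟨ b ⟩ (index (outer b)))
  jump-outside {D} {a} {b} confined@(inner-pegs , _) a∈ b∈ ab = independent , target∉
    where
    D′ = jumped D ⟨ a ⟩ ⟨ b ⟩ (index (outer b))
    ∈D′⁻ : ∀ {x} → x ∈ D′ → (x ∈ D × x ≢ ⟨ a ⟩ × x ≢ ⟨ b ⟩) ⊎ x ≡ index (outer b)
    ∈D′⁻ = ∈-jumped⁻ {D = D}
    landing-isolated : ∀ {y} → y ∈ D → y ≢ ⟨ b ⟩ → ¬ Adj G (index (outer b)) y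
    landing-isolated y∈ y≢b b~y with inner-pegs y∈
    ... | q , refl = y≢b (cong ⟨_⟩ (sym (partner-unique (index-Adj {outer b} {inner q} b~y))))
    independent : Independent G D′
    independent x y x∈ y∈ xy with ∈D′⁻ x∈ | ∈D′⁻ y∈
    ... | inj₂ refl | inj₂ refl = Adj-irrefl G {x} xy
    ... | inj₂ refl | inj₁ (y∈D , _ , y≢b) = landing-isolated y∈D y≢b xy
    ... | inj₁ (x∈D , _ , x≢b) | inj₂ refl = landing-isolated x∈D x≢b (Adj-sym G {x} {y} xy)
    ... | inj₁ (x∈D , x≢a , x≢b) | inj₁ (y∈D , y≢a , y≢b) with inner-pegs x∈D | inner-pegs y∈D
    ...   | p , refl | q , refl = disjoint-edges confined a∈ b∈ x∈D y∈D ab (innerEdge p q (index-Adj {inner p} {inner q} xy))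
                                    (⟨⟩≢ x≢a) (⟨⟩≢ x≢b) (⟨⟩≢ y≢a) (⟨⟩≢ y≢b)
    target∉ : index target ∉ D′
    target∉ t∈ with ∈D′⁻ t∈
    ... | inj₂ ()
    ... | inj₁ (t∈D , _) with inner-pegs t∈D
    ...   | _ , ()

  landing : ∀ {b w} → Adj G ⟨ b ⟩ w → (∃[ c ] w ≡ ⟨ c ⟩) ⊎ w ≡ index (outer b)
  landing {b} {w} b~w with inner-neighbour b (vertexAt w) (index-Adj {inner b} {vertexAt w} (subst (Adj G ⟨ b ⟩) (sym (index-vertexAt w)) b~w))
  ... | inj₁ (c , w≡c) = inj₁ (c , trans (sym (index-vertexAt w)) (cong index w≡c))
  ... | inj₂ w≡b′ = inj₂ (trans (sym (index-vertexAt w)) (cong index w≡b′))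

  safe-step : ∀ {D D′} → Move G D D′ → Safe D → Safe D′
  safe-step (u , v , _ , u∈ , v∈ , _ , uv , _ , _ , refl) (inj₂ (independent , _)) = contradiction uv (independent u v u∈ v∈)
  safe-step (u , v , w , u∈ , v∈ , _ , uv , w∉ , vw , refl) (inj₁ confined@(inner-pegs , _))
    with inner-pegs u∈ | inner-pegs v∈
  ... | a , refl | b , refl with landing {b} {w} vw
  ...   | inj₁ (c , refl) = inj₁ (jump-inside confined u∈ v∈ (innerEdge a b (index-Adj {inner a} {inner b} uv)) w∉)
  ...   | inj₂ refl = inj₂ (jump-outside confined u∈ v∈ (innerEdge a b (index-Adj {inner a} {inner b} uv)))

  safe-moves : ∀ {j D D′} → Moves G j D D′ → Safe D → Safe D′
  safe-moves done safe = safe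
  safe-moves (more mv mvs) safe = safe-moves mvs (safe-step mv safe)

  target-unreachable : ∀ {D} → Safe D → ¬ Reachable G D (index target)
  target-unreachable safe (_ , D′ , mvs , t∈) with safe-moves mvs safe
  ... | inj₁ (inner-pegs , _) = case inner-pegs t∈ of λ { (_ , ()) }
  ... | inj₂ (_ , t∉) = t∉ t∈

  -- the inner vertices other than the hub
  start : Fin (3 + k) → Fin N
  start i = ⟨ labelAt (suc i) ⟩

  start-injective : Injective _≡_ _≡_ start
  start-injective {i} {j} eq =
    suc-injective (trans (sym (index-labelAt (suc i))) (trans (cong labelIndex (⟨⟩-injective eq)) (index-labelAt (suc j))))

  labelAt-suc≢hub : ∀ i → labelAt (suc i) ≢ hub
  labelAt-suc≢hub i with splitAt 3 i
  ... | inj₁ _ = λ ()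
  ... | inj₂ _ = λ ()

  confined-start : ∀ {D} → D ⊆ image start → Confined D
  confined-start D⊆ = (λ x∈ → case ∈-image⁻ (D⊆ x∈) of λ (i , eq) → labelAt (suc i) , sym eq)
                    , (λ hub∈ → case ∈-image⁻ (D⊆ hub∈) of λ (i , eq) → contradiction (⟨⟩-injective eq) (labelAt-suc≢hub i))

  start-unreachable : ∀ D → D ⊆ image start → ¬ Reachable G D (index target)
  start-unreachable D D⊆ = target-unreachable (inj₁ (confined-start D⊆))

  k+4-pegs-suffice : GoodSize G (2 + k + 2)
  k+4-pegs-suffice D ∣D∣≡k+4 t = reachable {D = D} {t} (reach-within-3 α≤k+2 D (≤-reflexive (sym ∣D∣≡k+4)) t)
    where
    open Pegging G
    open VertexEdgeDiameter≤2 G (proj₁ (proj₂ VEDiam≡2))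

  PegNum≡k+4 : PegNum G (2 + k + 2)
  PegNum≡k+4 = s≤s z≤n , k+4-pegs-suffice , minimal
    where
    minimal : ∀ d → 1 ≤ d → d < 2 + k + 2 → ¬ GoodSize G d
    minimal d _ d<k+4 good =
      let D , D⊆ , ∣D∣≡d = subset-of-size (image start) d≤∣start∣
      in start-unreachable D D⊆ (good D ∣D∣≡d (index target))
      where
      d≤∣start∣ : d ≤ ∣ image start ∣
      d≤∣start∣ = ≤-trans (subst (λ m → d ≤ suc m) (+-comm k 2) (≤-pred d<k+4)) (injective⇒m≤∣image∣ start-injective)

  extremal : Diam G 2 × VEDiam G 2 × IndepNum G (2 + k) × PegNum G (2 + k + 2)
  extremal = (diameter≤2 , diameter≥2) , VEDiam≡2 , α≡k+2 , PegNum≡k+4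

theorem6p2 : (α : ℕ) → 2 ≤ α →
    ( ( (n : ℕ) (G : Graph n) → VEDiam G 2 → IndepNum G α →
          (p : ℕ) → PegNum G p → p ≤ α + 2 )
      × (∃[ n ] Σ (Graph n) λ G →
          Diam G 2 × VEDiam G 2 × IndepNum G α × PegNum G (α + 2)) )
    × ( (n : ℕ) (G : Graph n) → VEDiam G 2 → IndepNum G α →
          (D : Subset n) → α + 2 ≤ ∣ D ∣ → (t : Fin n) → ReachWithin G 3 D t )
    × ( (n : ℕ) (G : Graph n) → VEDiam G 2 → IndepNum G α → PegNum G (α + 2) →
          InducedSub graphA G × (Diam G 2 → InducedSub graphB G) )
theorem6p2 (suc (suc k)) (s≤s (s≤s z≤n)) =
  ( (λ _ G (_ , ve , _) (_ , bound) → PeggingNumber.PegNum≤α+2 G ve bound)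
  , (Example.N k , Example.G k , Example.extremal k) )
  , (λ _ G (_ , ve , _) (_ , bound) → VertexEdgeDiameter≤2.reach-within-3 G ve bound)
  , λ _ G (_ , ve , _) (_ , bound) P≡α+2 →
      PeggingNumber.PegNum≡α+2⇒A G ve bound P≡α+2 , PeggingNumber.PegNum≡α+2⇒B G ve bound P≡α+2 ∘ proj₁
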